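{- Let $\epsilon\le1/2000000$, let $G_0$ be a graph, $W$ an $\epsilon$-spectral cluster of $G_0$, $V\subseteq V(G_0)$ a set dominating $W$, and $G=G_0|V$. Then for every $S\subseteq V$, $\mathrm{vol}_{G_0}(W\cap S)\le\mathrm{vol}_G(W\cap S)+4\epsilon\,\mathrm{vol}_{G_0}(W)$.
   Context: Graphs are simple and undirected; $G_0|V$ is the induced subgraph on $V$. For a graph $H$, $\mathrm{vol}_H(S)=\sum_{v\in S}\deg_H(v)$, $E(S,T)$ is the set of edges between $S$ and $T$, $\partial_HS=E(S,V(H)\setminus S)$. An $\epsilon$-spectral cluster of $G_0$ is $W\subseteq V(G_0)$ with $|\partial_{G_0}W|\le\epsilon\,\mathrm{vol}_{G_0}(W)$ and such that for every $A\subseteq W$, with $r=\mathrm{vol}_{G_0}(A)/\mathrm{vol}_{G_0}(W)$, $|E(A,W\setminus A)|\ge(r(1-r)-\epsilon)\mathrm{vol}_{G_0}(W)$. $V$ dominates $W$ if $\mathrm{vol}_{G_0}(W\cap V)>(1-3\epsilon)\mathrm{vol}_{G_0}(W)$. -}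

module Defs where

open import Data.Bool using (Bool; true; false; if_then_else_; _∧_)
open import Data.Nat using (ℕ; zero; suc; _+_)
open import Data.Fin using (Fin)
open import Data.Vec using (lookup; tabulate; sum)
open import Data.Fin.Subset using (Subset; _∩_; ∁)
open import Data.Integer using (+_)
open import Data.Rational using (ℚ; _/_; 0ℚ)
open import Relation.Binary.PropositionalEquality using (_≡_)

record Graph (n : ℕ) : Set where
  field
    Adj    : Fin n → Fin n → Bool
    sym    : ∀ u v → Adj u v ≡ Adj v u
    irrefl : ∀ v → Adj v v ≡ false
open Graph public

_∈ᵇ_ : ∀ {n} → Fin n → Subset n → Bool
v ∈ᵇ S = lookup S v

Σᵥ : ∀ {n} → (Fin n → ℕ) → ℕ
Σᵥ f = sum (tabulate f)

indicator : Bool → ℕ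
indicator b = if b then 1 else 0

-- Induced subgraph G|V, kept on the same vertex type Fin n: vertices outside V
-- become isolated; degrees of vertices in V are those of the induced subgraph.
induced : ∀ {n} → Graph n → Subset n → Graph n
induced {n} G V = record
  { Adj = λ u v → (u ∈ᵇ V) ∧ ((v ∈ᵇ V) ∧ Adj G u v)
  ; sym = λ u v → lemma u v
  ; irrefl = λ v → lemma₂ v }
  where
  open import Relation.Binary.PropositionalEquality using (refl; cong)
  open import Data.Bool.Properties using (∧-zeroʳ)
  lemma : ∀ u v → (u ∈ᵇ V) ∧ ((v ∈ᵇ V) ∧ Adj G u v) ≡ (v ∈ᵇ V) ∧ ((u ∈ᵇ V) ∧ Adj G v u)
  lemma u v with u ∈ᵇ V | v ∈ᵇ V
  ... | false | false = refl
  ... | false | true  = refl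
  ... | true  | false = refl
  ... | true  | true  = sym G u v
  lemma₂ : ∀ v → (v ∈ᵇ V) ∧ ((v ∈ᵇ V) ∧ Adj G v v) ≡ false
  lemma₂ v with v ∈ᵇ V
  ... | false = refl
  ... | true  = irrefl G v

deg : ∀ {n} → Graph n → Fin n → ℕ
deg H v = Σᵥ (λ u → indicator (Adj H v u))

vol : ∀ {n} → Graph n → Subset n → ℕ
vol H S = Σᵥ (λ v → if v ∈ᵇ S then deg H v else 0)

-- |E(S,T)|: number of pairs (s,t), s ∈ S, t ∈ T, adjacent.
-- (Used only for disjoint S, T, where it equals the number of edges between them.)
edgesBetween : ∀ {n} → Graph n → Subset n → Subset n → ℕ
edgesBetween H S T =
  Σᵥ (λ s → Σᵥ (λ t → indicator ((s ∈ᵇ S) ∧ ((t ∈ᵇ T) ∧ Adj H s t))))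

boundary : ∀ {n} → Graph n → Subset n → ℕ
boundary H S = edgesBetween H S (∁ S)

ℕ→ℚ : ℕ → ℚ
ℕ→ℚ k = + k / 1

-- a / b as a rational (0 when b = 0; only used with vol(A) ≤ vol(W), where
-- for vol(W) = 0 the value of r is irrelevant since it is multiplied by vol(W)).
ratio : ℕ → ℕ → ℚ
ratio a zero    = 0ℚ
ratio a (suc b) = + a / suc b

-- Only the boundary of W and the domination of W by V matter.  For
-- v ∈ W ∩ S ⊆ V, passing from G₀ to G = G₀|V loses exactly the edges from v
-- to vertices outside V.  Such an edge either leaves W, and is counted in ∂W,
-- or ends in W \ V, and the latter edges number at most
-- vol(W \ V) = vol(W) − vol(W ∩ V) < 3ε vol(W).
-- Hence vol_{G₀}(W ∩ S) − vol_G(W ∩ S) ≤ |∂W| + vol(W \ V) ≤ 4ε vol(W).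
module Submission where

open import Defs hiding (sym)
import Algebra.Properties.CommutativeMonoid.Sum as MonoidSum
open import Data.Bool using (true; false; _∧_; not; if_then_else_)
open import Data.Bool.Properties using (∧-assoc; ∧-comm)
open import Data.Fin using (Fin; zero; suc)
open import Data.Fin.Subset using (Subset; _⊆_; _∩_; ∁; ⊤)
open import Data.Fin.Subset.Properties
  using (⊆-refl; ⊆-reflexive; ⊆-antisym; ⊆⊤; p∩q⊆p; p∩q⊆q; x∈p∩q⁺; x∈p∩q⁻; ∩-comm; ∩-identityˡ)
open import Data.Integer as Int using (+_; +≤+)
import Data.Integer.Properties as ℤ
open import Data.Nat as ℕ using (ℕ; z≤n)
import Data.Nat.Properties as ℕ
import Data.Nat.Coprimality as Coprimality
open import Data.Product using (_,_)
open import Data.Rational using (ℚ; mkℚ; *≤*; _/_; _+_; _-_; _*_; _≤_; _<_; 1ℚ; -_)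
import Data.Rational.Properties as ℚ
open import Data.Rational.Solver using (module +-*-Solver)
import Data.Vec as Vec
open import Data.Vec.Properties using (tabulate-cong; lookup-zipWith; lookup-map; lookup-replicate; []=⇒lookup; lookup⇒[]=)
open import Function using (_∘_)
open import Relation.Binary.PropositionalEquality

open MonoidSum ℕ.+-0-commutativeMonoid using (sum; sum-cong-≗; sum-replicate-zero; ∑-distrib-+; ∑-comm)
open +-*-Solver using (solve; con; _:+_; _:*_; _:-_; :-_; _:=_)

private
  variable
    n : ℕ

Σᵥ≡sum : (f : Fin n → ℕ) → Σᵥ f ≡ sum f
Σᵥ≡sum {ℕ.zero}  f = refl
Σᵥ≡sum {ℕ.suc n} f = cong (f zero ℕ.+_) (Σᵥ≡sum (f ∘ suc))

Σᵥ-cong : {f g : Fin n → ℕ} → (∀ i → f i ≡ g i) → Σᵥ f ≡ Σᵥ g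
Σᵥ-cong = cong Vec.sum ∘ tabulate-cong

Σᵥ-mono-≤ : {f g : Fin n → ℕ} → (∀ i → f i ℕ.≤ g i) → Σᵥ f ℕ.≤ Σᵥ g
Σᵥ-mono-≤ {ℕ.zero}  f≤g = z≤n
Σᵥ-mono-≤ {ℕ.suc n} f≤g = ℕ.+-mono-≤ (f≤g zero) (Σᵥ-mono-≤ (f≤g ∘ suc))

Σᵥ₂≡sum₂ : ∀ {m} (f : Fin m → Fin n → ℕ) → Σᵥ (λ i → Σᵥ (f i)) ≡ sum (λ i → sum (f i))
Σᵥ₂≡sum₂ f = trans (Σᵥ≡sum (λ i → Σᵥ (f i))) (sum-cong-≗ (Σᵥ≡sum ∘ f))

Σᵥ-zero : Σᵥ {n} (λ _ → 0) ≡ 0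
Σᵥ-zero {n} = trans (Σᵥ≡sum {n} (λ _ → 0)) (sum-replicate-zero n)

Σᵥ-+ : (f g : Fin n → ℕ) → Σᵥ (λ i → f i ℕ.+ g i) ≡ Σᵥ f ℕ.+ Σᵥ g
Σᵥ-+ f g = begin
  Σᵥ (λ i → f i ℕ.+ g i)  ≡⟨ Σᵥ≡sum (λ i → f i ℕ.+ g i) ⟩
  sum (λ i → f i ℕ.+ g i) ≡⟨ ∑-distrib-+ f g ⟩
  sum f ℕ.+ sum g         ≡⟨ cong₂ ℕ._+_ (Σᵥ≡sum f) (Σᵥ≡sum g) ⟨
  Σᵥ f ℕ.+ Σᵥ g           ∎
  where open ≡-Reasoning

Σᵥ-swap : ∀ {m} (f : Fin m → Fin n → ℕ) → Σᵥ (λ i → Σᵥ (f i)) ≡ Σᵥ (λ j → Σᵥ (λ i → f i j))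
Σᵥ-swap f = begin
  Σᵥ (λ i → Σᵥ (f i))          ≡⟨ Σᵥ₂≡sum₂ f ⟩
  sum (λ i → sum (f i))        ≡⟨ ∑-comm f ⟩
  sum (λ j → sum (λ i → f i j)) ≡⟨ Σᵥ₂≡sum₂ (λ j i → f i j) ⟨
  Σᵥ (λ j → Σᵥ (λ i → f i j))  ∎
  where open ≡-Reasoning

∈ᵇ-∩ : (v : Fin n) (S T : Subset n) → v ∈ᵇ (S ∩ T) ≡ (v ∈ᵇ S) ∧ (v ∈ᵇ T)
∈ᵇ-∩ v = lookup-zipWith _∧_ v

∈ᵇ-∁ : (v : Fin n) (S : Subset n) → v ∈ᵇ ∁ S ≡ not (v ∈ᵇ S)
∈ᵇ-∁ v = lookup-map v not

∈ᵇ-⊤ : (v : Fin n) → v ∈ᵇ ⊤ ≡ true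
∈ᵇ-⊤ v = lookup-replicate v true

⊆⇒∈ᵇ : {S T : Subset n} → S ⊆ T → ∀ v → v ∈ᵇ S ≡ true → v ∈ᵇ T ≡ true
⊆⇒∈ᵇ {S = S} S⊆T v v∈S = []=⇒lookup (S⊆T (lookup⇒[]= v S v∈S))

⊆⇒∩≡ : {S T : Subset n} → S ⊆ T → S ∩ T ≡ S
⊆⇒∩≡ {S = S} {T} S⊆T = ⊆-antisym (p∩q⊆p S T) (λ v∈S → x∈p∩q⁺ (v∈S , S⊆T v∈S))

indicator-∧-swap : ∀ s t a → indicator (s ∧ (t ∧ a)) ≡ indicator (t ∧ (s ∧ a))
indicator-∧-swap s t a = cong indicator (begin
  s ∧ (t ∧ a)  ≡⟨ ∧-assoc s t a ⟨
  (s ∧ t) ∧ a  ≡⟨ cong (_∧ a) (∧-comm s t) ⟩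
  (t ∧ s) ∧ a  ≡⟨ ∧-assoc t s a ⟩
  t ∧ (s ∧ a)  ∎)
  where open ≡-Reasoning

indicator-∧-mono : ∀ {s s′ t t′} a → (s ≡ true → s′ ≡ true) → (t ≡ true → t′ ≡ true) →
  indicator (s ∧ (t ∧ a)) ℕ.≤ indicator (s′ ∧ (t′ ∧ a))
indicator-∧-mono {false}                 a _    _    = z≤n
indicator-∧-mono {true} {t = false}      a _    _    = z≤n
indicator-∧-mono {true} {s′} {true} {t′} a s⇒s′ t⇒t′ rewrite s⇒s′ refl | t⇒t′ refl = ℕ.≤-refl

indicator-split : ∀ s t u a →
  indicator (s ∧ (t ∧ a)) ≡ indicator (s ∧ ((t ∧ u) ∧ a)) ℕ.+ indicator (s ∧ ((t ∧ not u) ∧ a))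
indicator-split false t     u     a = refl
indicator-split true  false u     a = refl
indicator-split true  true  true  a = sym (ℕ.+-identityʳ (indicator a))
indicator-split true  true  false a = refl

edgesBetween-sym : (H : Graph n) (S T : Subset n) → edgesBetween H S T ≡ edgesBetween H T S
edgesBetween-sym H S T = trans (Σᵥ-swap E) (Σᵥ-cong λ t → Σᵥ-cong λ s → begin
  indicator ((s ∈ᵇ S) ∧ ((t ∈ᵇ T) ∧ Adj H s t))  ≡⟨ indicator-∧-swap (s ∈ᵇ S) (t ∈ᵇ T) (Adj H s t) ⟩
  indicator ((t ∈ᵇ T) ∧ ((s ∈ᵇ S) ∧ Adj H s t))  ≡⟨ cong (λ a → indicator ((t ∈ᵇ T) ∧ ((s ∈ᵇ S) ∧ a))) (Graph.sym H s t) ⟩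
  indicator ((t ∈ᵇ T) ∧ ((s ∈ᵇ S) ∧ Adj H t s))  ∎)
  where
  open ≡-Reasoning
  E : Fin _ → Fin _ → ℕ
  E s t = indicator ((s ∈ᵇ S) ∧ ((t ∈ᵇ T) ∧ Adj H s t))

edgesBetween-mono : (H : Graph n) {S S′ T T′ : Subset n} → S ⊆ S′ → T ⊆ T′ →
  edgesBetween H S T ℕ.≤ edgesBetween H S′ T′
edgesBetween-mono H S⊆S′ T⊆T′ = Σᵥ-mono-≤ λ s → Σᵥ-mono-≤ λ t →
  indicator-∧-mono (Adj H s t) (⊆⇒∈ᵇ S⊆S′ s) (⊆⇒∈ᵇ T⊆T′ t)

edgesBetween-split : (H : Graph n) (S T U : Subset n) →
  edgesBetween H S T ≡ edgesBetween H S (T ∩ U) ℕ.+ edgesBetween H S (T ∩ ∁ U)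
edgesBetween-split H S T U = begin
  edgesBetween H S T
    ≡⟨ Σᵥ-cong (λ s → Σᵥ-cong (λ t → split s t)) ⟩
  Σᵥ (λ s → Σᵥ (λ t → E (T ∩ U) s t ℕ.+ E (T ∩ ∁ U) s t))
    ≡⟨ Σᵥ-cong (λ s → Σᵥ-+ (E (T ∩ U) s) (E (T ∩ ∁ U) s)) ⟩
  Σᵥ (λ s → Σᵥ (E (T ∩ U) s) ℕ.+ Σᵥ (E (T ∩ ∁ U) s))
    ≡⟨ Σᵥ-+ (Σᵥ ∘ E (T ∩ U)) (Σᵥ ∘ E (T ∩ ∁ U)) ⟩
  edgesBetween H S (T ∩ U) ℕ.+ edgesBetween H S (T ∩ ∁ U) ∎
  where
  open ≡-Reasoning
  E : Subset _ → Fin _ → Fin _ → ℕ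
  E X s t = indicator ((s ∈ᵇ S) ∧ ((t ∈ᵇ X) ∧ Adj H s t))
  split : ∀ s t → E T s t ≡ E (T ∩ U) s t ℕ.+ E (T ∩ ∁ U) s t
  split s t rewrite ∈ᵇ-∩ t T U | ∈ᵇ-∩ t T (∁ U) | ∈ᵇ-∁ t U =
    indicator-split (s ∈ᵇ S) (t ∈ᵇ T) (t ∈ᵇ U) (Adj H s t)

∧-restrict : ∀ s s′ t t′ a → s ∧ (t ∧ (s′ ∧ (t′ ∧ a))) ≡ (s ∧ s′) ∧ ((t ∧ t′) ∧ a)
∧-restrict false s′    t     t′ a = refl
∧-restrict true  false false t′ a = refl
∧-restrict true  false true  t′ a = refl
∧-restrict true  true  false t′ a = refl
∧-restrict true  true  true  t′ a = refl

edgesBetween-induced : (H : Graph n) (V S T : Subset n) →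
  edgesBetween (induced H V) S T ≡ edgesBetween H (S ∩ V) (T ∩ V)
edgesBetween-induced H V S T = Σᵥ-cong λ s → Σᵥ-cong λ t →
  trans (cong indicator (∧-restrict (s ∈ᵇ S) (s ∈ᵇ V) (t ∈ᵇ T) (t ∈ᵇ V) (Adj H s t)))
        (cong₂ (λ x y → indicator (x ∧ (y ∧ Adj H s t))) (sym (∈ᵇ-∩ s S V)) (sym (∈ᵇ-∩ t T V)))

vol≡edgesBetween-⊤ : (H : Graph n) (S : Subset n) → vol H S ≡ edgesBetween H S ⊤
vol≡edgesBetween-⊤ {n} H S = Σᵥ-cong degree-in-S
  where
  degree-in-S : ∀ v → (if v ∈ᵇ S then deg H v else 0)
                    ≡ Σᵥ (λ u → indicator ((v ∈ᵇ S) ∧ ((u ∈ᵇ ⊤) ∧ Adj H v u)))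
  degree-in-S v with v ∈ᵇ S
  ... | true  = Σᵥ-cong λ u → cong (λ b → indicator (b ∧ Adj H v u)) (sym (∈ᵇ-⊤ u))
  ... | false = sym (Σᵥ-zero {n})

vol-split : (H : Graph n) (S U : Subset n) → vol H S ≡ vol H (S ∩ U) ℕ.+ vol H (S ∩ ∁ U)
vol-split H S U = begin
  vol H S                                                  ≡⟨ vol≡edgesBetween-⊤ H S ⟩
  edgesBetween H S ⊤                                       ≡⟨ edgesBetween-sym H S ⊤ ⟩
  edgesBetween H ⊤ S                                       ≡⟨ edgesBetween-split H ⊤ S U ⟩
  edgesBetween H ⊤ (S ∩ U) ℕ.+ edgesBetween H ⊤ (S ∩ ∁ U)  ≡⟨ cong₂ ℕ._+_ (vol-as-edges (S ∩ U)) (vol-as-edges (S ∩ ∁ U)) ⟨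
  vol H (S ∩ U) ℕ.+ vol H (S ∩ ∁ U)                        ∎
  where
  open ≡-Reasoning
  vol-as-edges : ∀ X → vol H X ≡ edgesBetween H ⊤ X
  vol-as-edges X = trans (vol≡edgesBetween-⊤ H X) (edgesBetween-sym H X ⊤)

edgesBetween-≤-vol : (H : Graph n) (S T : Subset n) → edgesBetween H S T ℕ.≤ vol H T
edgesBetween-≤-vol H S T = begin
  edgesBetween H S T  ≡⟨ edgesBetween-sym H S T ⟩
  edgesBetween H T S  ≤⟨ edgesBetween-mono H {T} {T} {S} ⊆-refl ⊆⊤ ⟩
  edgesBetween H T ⊤  ≡⟨ vol≡edgesBetween-⊤ H T ⟨
  vol H T             ∎
  where open ℕ.≤-Reasoning

vol-induced : (H : Graph n) {S V : Subset n} → S ⊆ V →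
  vol H S ≡ vol (induced H V) S ℕ.+ edgesBetween H S (∁ V)
vol-induced H {S} {V} S⊆V = begin
  vol H S                                                  ≡⟨ vol≡edgesBetween-⊤ H S ⟩
  edgesBetween H S ⊤                                       ≡⟨ edgesBetween-split H S ⊤ V ⟩
  edgesBetween H S (⊤ ∩ V) ℕ.+ edgesBetween H S (⊤ ∩ ∁ V)  ≡⟨ cong (ℕ._+ edgesBetween H S (⊤ ∩ ∁ V)) induced-part ⟩
  vol (induced H V) S ℕ.+ edgesBetween H S (⊤ ∩ ∁ V)       ≡⟨ cong (λ X → vol (induced H V) S ℕ.+ edgesBetween H S X) (∩-identityˡ (∁ V)) ⟩
  vol (induced H V) S ℕ.+ edgesBetween H S (∁ V)           ∎
  where
  open ≡-Reasoning
  induced-part : edgesBetween H S (⊤ ∩ V) ≡ vol (induced H V) S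
  induced-part = begin
    edgesBetween H S (⊤ ∩ V)              ≡⟨ cong (λ X → edgesBetween H X (⊤ ∩ V)) (⊆⇒∩≡ S⊆V) ⟨
    edgesBetween H (S ∩ V) (⊤ ∩ V)        ≡⟨ edgesBetween-induced H V S ⊤ ⟨
    edgesBetween (induced H V) S ⊤        ≡⟨ vol≡edgesBetween-⊤ (induced H V) S ⟨
    vol (induced H V) S                   ∎

vol-≤-vol-induced : (H : Graph n) (W V S : Subset n) → S ⊆ V →
  vol H (W ∩ S) ℕ.≤ vol (induced H V) (W ∩ S) ℕ.+ boundary H W ℕ.+ vol H (W ∩ ∁ V)
vol-≤-vol-induced H W V S S⊆V = begin
  vol H X
    ≡⟨ vol-induced H X⊆V ⟩
  vol (induced H V) X ℕ.+ edgesBetween H X (∁ V)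
    ≡⟨ cong (vol (induced H V) X ℕ.+_) (edgesBetween-split H X (∁ V) W) ⟩
  vol (induced H V) X ℕ.+ (edgesBetween H X (∁ V ∩ W) ℕ.+ edgesBetween H X (∁ V ∩ ∁ W))
    ≤⟨ ℕ.+-monoʳ-≤ (vol (induced H V) X) (ℕ.+-mono-≤ into-W∖V leaving-W) ⟩
  vol (induced H V) X ℕ.+ (vol H (W ∩ ∁ V) ℕ.+ boundary H W)
    ≡⟨ cong (vol (induced H V) X ℕ.+_) (ℕ.+-comm (vol H (W ∩ ∁ V)) (boundary H W)) ⟩
  vol (induced H V) X ℕ.+ (boundary H W ℕ.+ vol H (W ∩ ∁ V))
    ≡⟨ ℕ.+-assoc (vol (induced H V) X) (boundary H W) (vol H (W ∩ ∁ V)) ⟨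
  vol (induced H V) X ℕ.+ boundary H W ℕ.+ vol H (W ∩ ∁ V)  ∎
  where
  open ℕ.≤-Reasoning
  X = W ∩ S
  X⊆W∩V : X ⊆ W ∩ V
  X⊆W∩V v∈X with x∈p∩q⁻ W S v∈X
  ... | v∈W , v∈S = x∈p∩q⁺ (v∈W , S⊆V v∈S)
  X⊆V : X ⊆ V
  X⊆V = p∩q⊆q W V ∘ X⊆W∩V
  into-W∖V : edgesBetween H X (∁ V ∩ W) ℕ.≤ vol H (W ∩ ∁ V)
  into-W∖V = begin
    edgesBetween H X (∁ V ∩ W)            ≤⟨ edgesBetween-mono H X⊆W∩V (⊆-reflexive (∩-comm (∁ V) W)) ⟩
    edgesBetween H (W ∩ V) (W ∩ ∁ V)      ≤⟨ edgesBetween-≤-vol H (W ∩ V) (W ∩ ∁ V) ⟩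
    vol H (W ∩ ∁ V)                       ∎
  leaving-W : edgesBetween H X (∁ V ∩ ∁ W) ℕ.≤ boundary H W
  leaving-W = edgesBetween-mono H (p∩q⊆p W S) (p∩q⊆q (∁ V) (∁ W))

ℕ→ℚ≡mkℚ : ∀ k → ℕ→ℚ k ≡ mkℚ (+ k) 0 (Coprimality.sym (Coprimality.1-coprimeTo k))
ℕ→ℚ≡mkℚ k = ℚ.normalize-coprime (Coprimality.sym (Coprimality.1-coprimeTo k))

ℕ→ℚ-+ : ∀ m k → ℕ→ℚ (m ℕ.+ k) ≡ ℕ→ℚ m + ℕ→ℚ k
ℕ→ℚ-+ m k rewrite ℕ→ℚ≡mkℚ m | ℕ→ℚ≡mkℚ k =
  cong (_/ 1) (sym (cong₂ Int._+_ (ℤ.*-identityʳ (+ m)) (ℤ.*-identityʳ (+ k))))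

ℕ→ℚ-mono-≤ : ∀ {m k} → m ℕ.≤ k → ℕ→ℚ m ≤ ℕ→ℚ k
ℕ→ℚ-mono-≤ {m} {k} m≤k rewrite ℕ→ℚ≡mkℚ m | ℕ→ℚ≡mkℚ k =
  *≤* (ℤ.*-monoʳ-≤-nonNeg (+ 1) (+≤+ m≤k))

+-cancelʳ-≤ : ∀ r {p q} → p + r ≤ q + r → p ≤ q
+-cancelʳ-≤ r {p} {q} p+r≤q+r =
  subst₂ _≤_ (minus-r p) (minus-r q) (ℚ.+-monoˡ-≤ (- r) p+r≤q+r)
  where
  minus-r : ∀ x → x + r + - r ≡ x
  minus-r x = solve 2 (λ x y → x :+ y :+ :- y := x) refl x r

domination-bound : ∀ (ε a b c d e w : ℚ) →
  a ≤ b + d + e → c + e ≡ w → d ≤ ε * w → (1ℚ - (+ 3 / 1) * ε) * w < c →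
  a ≤ b + (+ 4 / 1) * ε * w
domination-bound ε a b c d e w a≤b+d+e c+e≡w d≤εw c-large = +-cancelʳ-≤ c (begin
  a + c                                       ≤⟨ ℚ.+-monoˡ-≤ c a≤b+d+e ⟩
  b + d + e + c                               ≡⟨ solve 4 (λ b d e c → b :+ d :+ e :+ c := b :+ d :+ (c :+ e)) refl b d e c ⟩
  b + d + (c + e)                             ≡⟨ cong (λ x → b + d + x) c+e≡w ⟩
  b + d + w                                   ≤⟨ ℚ.+-monoˡ-≤ w (ℚ.+-monoʳ-≤ b d≤εw) ⟩
  b + ε * w + w                               ≡⟨ solve 3 (λ ε b w → b :+ ε :* w :+ w
                                                   := b :+ con (+ 4 / 1) :* ε :* w :+ (con 1ℚ :- con (+ 3 / 1) :* ε) :* w) refl ε b w ⟩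
  b + (+ 4 / 1) * ε * w + (1ℚ - (+ 3 / 1) * ε) * w  ≤⟨ ℚ.+-monoʳ-≤ (b + (+ 4 / 1) * ε * w) (ℚ.<⇒≤ c-large) ⟩
  b + (+ 4 / 1) * ε * w + c                   ∎)
  where open ℚ.≤-Reasoning

lemma6 : (ε : ℚ) → ε ≤ (+ 1 / 2000000) →
    (n : ℕ) (G₀ : Graph n) (W V : Subset n) →
    (ℕ→ℚ (boundary G₀ W) ≤ ε * ℕ→ℚ (vol G₀ W)) →
    ((A : Subset n) → A ⊆ W →
      ((ratio (vol G₀ A) (vol G₀ W) * (1ℚ - ratio (vol G₀ A) (vol G₀ W)) - ε)
          * ℕ→ℚ (vol G₀ W)
        ≤ ℕ→ℚ (edgesBetween G₀ A (W ∩ ∁ A)))) →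
    ((1ℚ - (+ 3 / 1) * ε) * ℕ→ℚ (vol G₀ W) < ℕ→ℚ (vol G₀ (W ∩ V))) →
    (S : Subset n) → S ⊆ V →
    ℕ→ℚ (vol G₀ (W ∩ S))
      ≤ ℕ→ℚ (vol (induced G₀ V) (W ∩ S)) + (+ 4 / 1) * ε * ℕ→ℚ (vol G₀ W)
lemma6 ε _ _ G₀ W V boundary-small _ dominated S S⊆V =
  domination-bound ε (ℕ→ℚ a) (ℕ→ℚ b) (ℕ→ℚ c) (ℕ→ℚ d) (ℕ→ℚ e) (ℕ→ℚ w)
    loss-bound split boundary-small dominated
  where
  a = vol G₀ (W ∩ S)
  b = vol (induced G₀ V) (W ∩ S)
  c = vol G₀ (W ∩ V)
  d = boundary G₀ W
  e = vol G₀ (W ∩ ∁ V)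
  w = vol G₀ W
  loss-bound : ℕ→ℚ a ≤ ℕ→ℚ b + ℕ→ℚ d + ℕ→ℚ e
  loss-bound = subst (ℕ→ℚ a ≤_) (trans (ℕ→ℚ-+ (b ℕ.+ d) e) (cong (_+ ℕ→ℚ e) (ℕ→ℚ-+ b d)))
    (ℕ→ℚ-mono-≤ (vol-≤-vol-induced G₀ W V S S⊆V))
  split : ℕ→ℚ c + ℕ→ℚ e ≡ ℕ→ℚ w
  split = trans (sym (ℕ→ℚ-+ c e)) (cong ℕ→ℚ (sym (vol-split G₀ W V)))
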